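{- Let $X$ be a type, $\varphi\colon X^{\mathbb{N}}\to\mathbb{N}$ and $u\colon X^\dagger$, and for each $i$ put $n_{\varphi,i}:=\hat\varphi([u]^{\varphi}_{i})$. Then $u$ is a $\varphi$-thread (i.e. $S_\varphi(u)$ holds) if and only if for all $i\le |\mathrm{dom}(u)|$ $$[u]^{\varphi}_{i}=(n_{\varphi,0},x_0)\oplus(n_{\varphi,1},x_1)\oplus\cdots\oplus(n_{\varphi,i-1},x_{i-1}),$$ where $x_j=u(n_{\varphi,j})$ and the numbers $n_{\varphi,0},\dots,n_{\varphi,i-1}$ are pairwise distinct and all lie in $\mathrm{dom}(u)$. In particular, if $S_\varphi(u)$ then $u=[u]^{\varphi}_{l}=(n_{\varphi,0},x_0)\oplus\cdots\oplus(n_{\varphi,l-1},x_{l-1})$ where $l=|\mathrm{dom}(u)|$.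
   Context: $X^{\mathbb{N}}$ is the type of infinite sequences $\mathbb{N}\to X$. $X^\dagger$ is the type of finite partial functions from $\mathbb{N}$ to $X$, i.e. partial maps with finite domain $\mathrm{dom}(u)$, where membership in $\mathrm{dom}(u)$ is decidable; $|\mathrm{dom}(u)|$ is the number of elements of the domain. Every type has a canonical element $\mathbf{0}_X$. For $u\colon X^\dagger$, $\hat u\colon X^{\mathbb{N}}$ is defined by $\hat u(i)=u(i)$ if $i\in\mathrm{dom}(u)$ and $\hat u(i)=\mathbf{0}_X$ otherwise; $\hat\varphi(u):=\varphi(\hat u)$. $\emptyset$ is the nowhere-defined partial function and $(n,x)$ the partial function defined only at $n$, with value $x$. For $u\colon X^\dagger$, $u\oplus(n,x)$ equals $u$ if $n\in\mathrm{dom}(u)$, and otherwise is $u$ extended by the value $x$ at $n$; $\oplus$ associates to the left. The $\varphi$-thread of $u$ of length $i$, $[u]^{\varphi}_{i}\colon X^\dagger$, is defined by $[u]^{\varphi}_{0}=\emptyset$ and $[u]^{\varphi}_{i+1}=[u]^{\varphi}_{i}\oplus(n_{\varphi,i},u(n_{\varphi,i}))$ if $n_{\varphi,i}\in\mathrm{dom}(u)$, and $[u]^{\varphi}_{i+1}=[u]^{\varphi}_{i}$ otherwise, where $n_{\varphi,i}:=\hat\varphi([u]^{\varphi}_{i})$. The predicate $S_\varphi(u)$ ("$u$ is a $\varphi$-thread") means $u=[u]^{\varphi}_{|\mathrm{dom}(u)|}$. -}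

module Defs where

open import Data.Nat using (ℕ; zero; suc; _≤_; _<_; _⊔_; _≟_)
open import Data.Nat.Properties using (≤-trans; <-irrefl; m≤m⊔n; m≤n⊔m; <⇒≢)
open import Data.Maybe using (Maybe; just; nothing; fromMaybe; is-just)
open import Data.Bool using (if_then_else_)
open import Data.List using (upTo; map)
open import Data.Nat.ListAction using (sum)
open import Data.Empty using (⊥-elim)
open import Data.Product using (Σ; _×_; _,_)
open import Relation.Binary.PropositionalEquality using (_≡_; _≢_; refl; sym)
open import Relation.Nullary using (yes; no)

-- X† : finite partial functions ℕ ⇀ X, represented by a Maybe-valued
-- function that vanishes beyond some bound (so the domain is finite and
-- membership in it is decidable).  The bound is bookkeeping only; equality
-- of partial functions is extensional (_≈†_ below).
record PFun (X : Set) : Set where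
  field
    fn     : ℕ → Maybe X
    bound  : ℕ
    vanish : ∀ n → bound ≤ n → fn n ≡ nothing
open PFun public

module _ {X : Set} where

  _∈dom_ : ℕ → PFun X → Set
  n ∈dom u = Σ X λ x → fn u n ≡ just x

  _≈†_ : PFun X → PFun X → Set
  u ≈† v = ∀ n → fn u n ≡ fn v n

  size : PFun X → ℕ
  size u = sum (map (λ n → if is-just (fn u n) then 1 else 0) (upTo (bound u)))

  hat : X → PFun X → (ℕ → X)
  hat 0X u i = fromMaybe 0X (fn u i)

  ∅ : PFun X
  ∅ = record { fn = λ _ → nothing ; bound = 0 ; vanish = λ _ _ → refl }

  private
    upd : (ℕ → Maybe X) → ℕ → X → ℕ → Maybe X
    upd f n x m with m ≟ n
    ... | yes _ = just x
    ... | no  _ = f m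

    extend : PFun X → ℕ → X → PFun X
    extend u n x = record { fn = upd (fn u) n x ; bound = suc n ⊔ bound u ; vanish = v }
      where
      v : ∀ m → suc n ⊔ bound u ≤ m → upd (fn u) n x m ≡ nothing
      v m le with m ≟ n
      ... | yes m≡n = ⊥-elim (<-irrefl (sym m≡n) (≤-trans (m≤m⊔n (suc n) (bound u)) le))
      ... | no  _   = vanish u m (≤-trans (m≤n⊔m (suc n) (bound u)) le)

    ⊕-aux : (u : PFun X) → ℕ → X → Maybe X → PFun X
    ⊕-aux u n x (just _) = u
    ⊕-aux u n x nothing  = extend u n x

  infixl 6 _⊕_
  _⊕_ : PFun X → ℕ × X → PFun X
  u ⊕ (n , x) = ⊕-aux u n x (fn u n)

module _ {X : Set} (0X : X) (φ : (ℕ → X) → ℕ) (u : PFun X) where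

  private
    step : PFun X → Maybe X → ℕ → PFun X
    step t (just x) n = t ⊕ (n , x)
    step t nothing  n = t

  thread : ℕ → PFun X
  thread zero    = ∅
  thread (suc i) = step (thread i) (fn u (φ (hat 0X (thread i)))) (φ (hat 0X (thread i)))

  nφ : ℕ → ℕ
  nφ i = φ (hat 0X (thread i))

  -- (n_{φ,0}, x_0) ⊕ ... ⊕ (n_{φ,i-1}, x_{i-1}), with x_j = u(n_{φ,j})
  -- (read as û(n_{φ,j}), which equals u(n_{φ,j}) when n_{φ,j} ∈ dom u)
  chain : ℕ → PFun X
  chain zero    = ∅
  chain (suc i) = chain i ⊕ (nφ i , hat 0X u (nφ i))

  IsThread : Set
  IsThread = u ≈† thread (size u)

  ThreadCond : ℕ → Set
  ThreadCond i =
      (thread i ≈† chain i)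
    × (∀ j k → j < i → k < i → j ≢ k → nφ j ≢ nφ k)
    × (∀ j → j < i → nφ j ∈dom u)

module Submission where

-- The proof is a counting argument.  First, for finite partial functions we
-- show how the size |dom t| behaves: it is invariant under extensional
-- equality, it grows by exactly one when ⊕ adds a new point, and a
-- sub-graph of the same size is the whole function.  Second, for the thread
-- [u]_i we show that each step either is fresh or leaves the thread
-- unchanged, that the thread only grows, stays inside u, and has its domain
-- among the chosen points n_{φ,k} (k < i).  Hence |[u]_k| = k exactly when
-- the first k steps are all fresh.  For a fresh prefix the thread is the
-- ⊕-chain of the chosen points, which are pairwise distinct and lie in
-- dom u; conversely distinctness forces freshness.  Finally, S_φ(u) says
-- u = [u]_l with l = |dom u|, which by the size facts is equivalent to
-- |[u]_l| = l, i.e. to all l steps being fresh.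

open import Defs
open import Data.Nat using (ℕ; zero; suc; _+_; _≤_; _<_; _≤′_; ≤′-refl; ≤′-step; _⊔_; _≟_; z≤n; s≤s; s≤s⁻¹)
open import Data.Nat.Properties
open import Data.Maybe using (Maybe; just; nothing; fromMaybe; is-just)
open import Data.Bool using (if_then_else_)
open import Data.List using ([_]; _++_; map; upTo)
open import Data.List.Properties using (map-++; upTo-∷ʳ)
open import Data.Nat.ListAction using (sum)
open import Data.Nat.ListAction.Properties using (sum-++)
open import Data.Product using (Σ; _×_; _,_; proj₁; proj₂)
open import Data.Sum using (_⊎_; inj₁; inj₂)
open import Data.Empty using (⊥-elim)
open import Function using (_∘_)
open import Relation.Binary.PropositionalEquality using (_≡_; _≢_; refl; sym; trans; cong; cong₂; subst; subst₂; module ≡-Reasoning)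
open import Relation.Binary.Definitions using (tri<; tri≈; tri>)
open import Relation.Nullary using (yes; no)

module _ {X : Set} where

  infix 4 _⊆_ _⊑_
  _⊆_ : (ℕ → Maybe X) → (ℕ → Maybe X) → Set
  f ⊆ g = ∀ m y → f m ≡ just y → g m ≡ just y

  _⊑_ : PFun X → PFun X → Set
  a ⊑ b = fn a ⊆ fn b

  defined : Maybe X → ℕ
  defined m = if is-just m then 1 else 0

  count : (ℕ → Maybe X) → ℕ → ℕ
  count f N = sum (map (defined ∘ f) (upTo N))

  defined≤1 : (m : Maybe X) → defined m ≤ 1
  defined≤1 (just _) = s≤s z≤n
  defined≤1 nothing  = z≤n

  defined-mono : (m m′ : Maybe X) → (∀ y → m ≡ just y → m′ ≡ just y) → defined m ≤ defined m′
  defined-mono nothing  _ _ = z≤n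
  defined-mono (just y) m′ inc rewrite inc y refl = ≤-refl

  count-suc : ∀ f N → count f (suc N) ≡ count f N + defined (f N)
  count-suc f N = begin
    sum (map g (upTo (suc N)))          ≡⟨ cong (sum ∘ map g) (sym (upTo-∷ʳ N)) ⟩
    sum (map g (upTo N ++ [ N ]))       ≡⟨ cong sum (map-++ g (upTo N) [ N ]) ⟩
    sum (map g (upTo N) ++ [ g N ])     ≡⟨ sum-++ (map g (upTo N)) [ g N ] ⟩
    count f N + (g N + 0)               ≡⟨ cong (count f N +_) (+-identityʳ (g N)) ⟩
    count f N + g N                     ∎
    where
    open ≡-Reasoning
    g : ℕ → ℕ
    g = defined ∘ f

  count-beyond : ∀ f b → (∀ m → b ≤ m → f m ≡ nothing) → ∀ N → b ≤ N → count f N ≡ count f b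
  count-beyond f b v N b≤N with ≤⇒≤′ b≤N
  ... | ≤′-refl = refl
  ... | ≤′-step {N′} b≤′N′ = begin
    count f (suc N′)            ≡⟨ count-suc f N′ ⟩
    count f N′ + defined (f N′) ≡⟨ cong (λ m → count f N′ + defined m) (v N′ b≤N′) ⟩
    count f N′ + 0              ≡⟨ +-identityʳ _ ⟩
    count f N′                  ≡⟨ count-beyond f b v N′ b≤N′ ⟩
    count f b                   ∎
    where
    open ≡-Reasoning
    b≤N′ : b ≤ N′
    b≤N′ = ≤′⇒≤ b≤′N′

  count-cong : ∀ f g N → (∀ m → m < N → f m ≡ g m) → count f N ≡ count g N
  count-cong f g zero    eq = refl
  count-cong f g (suc N) eq = begin
    count f (suc N)           ≡⟨ count-suc f N ⟩
    count f N + defined (f N) ≡⟨ cong₂ _+_ (count-cong f g N (λ m m<N → eq m (m<n⇒m<1+n m<N)))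
                                           (cong defined (eq N ≤-refl)) ⟩
    count g N + defined (g N) ≡⟨ sym (count-suc g N) ⟩
    count g (suc N)           ∎
    where open ≡-Reasoning

  count-one-point : ∀ f g p → (∀ m → m ≢ p → g m ≡ f m) → ∀ N → count g N ≤ suc (count f N)
  count-one-point f g p eq zero = z≤n
  count-one-point f g p eq (suc N) rewrite count-suc f N | count-suc g N with N ≟ p
  ... | yes refl rewrite count-cong g f N (λ m m<N → eq m (<⇒≢ m<N)) =
    begin
      count f N + defined (g N) ≤⟨ +-monoʳ-≤ (count f N) (defined≤1 (g N)) ⟩
      count f N + 1             ≡⟨ +-comm (count f N) 1 ⟩
      suc (count f N)           ≤⟨ s≤s (m≤m+n _ _) ⟩
      suc (count f N + defined (f N)) ∎
    where open ≤-Reasoning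
  ... | no N≢p rewrite eq N N≢p = +-monoˡ-≤ (defined (f N)) (count-one-point f g p eq N)

  count-mono : ∀ f g → f ⊆ g → ∀ N → count f N ≤ count g N
  count-mono f g f⊆g zero    = z≤n
  count-mono f g f⊆g (suc N) rewrite count-suc f N | count-suc g N =
    +-mono-≤ (count-mono f g f⊆g N) (defined-mono (f N) (g N) (f⊆g N))

  count-strict : ∀ f g → f ⊆ g → ∀ p y → f p ≡ nothing → g p ≡ just y
    → ∀ N → p < N → count f N < count g N
  count-strict f g f⊆g p y fp gp (suc N) (s≤s p≤N) rewrite count-suc f N | count-suc g N with p ≟ N
  ... | yes refl rewrite fp | gp = +-mono-≤-< (count-mono f g f⊆g p) (s≤s z≤n)
  ... | no p≢N = +-mono-<-≤ (count-strict f g f⊆g p y fp gp N (≤∧≢⇒< p≤N p≢N))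
                            (defined-mono (f N) (g N) (f⊆g N))

  size-at : ∀ (t : PFun X) N → bound t ≤ N → size t ≡ count (fn t) N
  size-at t N le = sym (count-beyond (fn t) (bound t) (vanish t) N le)

  defined-below-bound : ∀ (t : PFun X) p y → fn t p ≡ just y → p < bound t
  defined-below-bound t p y tp with ≤-<-connex (bound t) p
  ... | inj₂ p<b = p<b
  ... | inj₁ b≤p with trans (sym tp) (vanish t p b≤p)
  ... | ()

  size-cong : ∀ (a b : PFun X) → a ≈† b → size a ≡ size b
  size-cong a b a≈b = begin
    size a               ≡⟨ size-at a N (m≤m⊔n _ _) ⟩
    count (fn a) N       ≡⟨ count-cong (fn a) (fn b) N (λ m _ → a≈b m) ⟩
    count (fn b) N       ≡⟨ sym (size-at b N (m≤n⊔m _ _)) ⟩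
    size b               ∎
    where
    open ≡-Reasoning
    N : ℕ
    N = bound a ⊔ bound b

  size-strict : ∀ (a b : PFun X) → a ⊑ b → ∀ p y → fn a p ≡ nothing → fn b p ≡ just y
    → size a < size b
  size-strict a b a⊑b p y ap bp =
    subst₂ _<_ (sym (size-at a N (m≤m⊔n _ _))) (sym (size-at b N (m≤n⊔m _ _)))
      (count-strict (fn a) (fn b) a⊑b p y ap bp N
        (<-≤-trans (defined-below-bound b p y bp) (m≤n⊔m _ _)))
    where
    N : ℕ
    N = bound a ⊔ bound b

  ⊑-size-≈ : ∀ (a b : PFun X) → a ⊑ b → size b ≤ size a → a ≈† b
  ⊑-size-≈ a b a⊑b b≤a m with fn a m in am | fn b m in bm
  ... | just y  | _       = trans (sym (a⊑b m y am)) bm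
  ... | nothing | nothing = refl
  ... | nothing | just y  = ⊥-elim (<⇒≱ (size-strict a b a⊑b m y am bm) b≤a)

  ⊕-absorb : ∀ (t : PFun X) n x y → fn t n ≡ just y → t ⊕ (n , x) ≡ t
  ⊕-absorb t n x y tn rewrite tn = refl

  ⊕-other : ∀ (t : PFun X) n x m → m ≢ n → fn (t ⊕ (n , x)) m ≡ fn t m
  ⊕-other t n x m m≢n with fn t n
  ... | just _  = refl
  ... | nothing with m ≟ n
  ... | yes m≡n = ⊥-elim (m≢n m≡n)
  ... | no _    = refl

  ⊕-new : ∀ (t : PFun X) n x → fn t n ≡ nothing → fn (t ⊕ (n , x)) n ≡ just x
  ⊕-new t n x tn rewrite tn with n ≟ n
  ... | yes _   = refl
  ... | no n≢n  = ⊥-elim (n≢n refl)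

  ⊕-extends : ∀ (t : PFun X) n x → t ⊑ t ⊕ (n , x)
  ⊕-extends t n x m y tm with m ≟ n
  ... | yes refl rewrite ⊕-absorb t m x y tm = tm
  ... | no m≢n   = trans (⊕-other t n x m m≢n) tm

  ⊕-⊑ : ∀ (t v : PFun X) n x → t ⊑ v → fn v n ≡ just x → t ⊕ (n , x) ⊑ v
  ⊕-⊑ t v n x t⊑v vn m y ⊕m with m ≟ n
  ... | no m≢n   = t⊑v m y (trans (sym (⊕-other t n x m m≢n)) ⊕m)
  ... | yes refl = old-or-new (fn t m) refl
    where
    old-or-new : ∀ tm → fn t m ≡ tm → fn v m ≡ just y
    old-or-new (just z) tm = t⊑v m y (trans (sym (cong (λ s → fn s m) (⊕-absorb t m x z tm))) ⊕m)
    old-or-new nothing  tm = trans vn (trans (sym (⊕-new t m x tm)) ⊕m)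

  ⊕-cong : ∀ (a b : PFun X) n x → a ≈† b → (a ⊕ (n , x)) ≈† (b ⊕ (n , x))
  ⊕-cong a b n x a≈b m with m ≟ n
  ... | no m≢n = trans (⊕-other a n x m m≢n) (trans (a≈b m) (sym (⊕-other b n x m m≢n)))
  ... | yes refl = old-or-new (fn a m) refl
    where
    at-m : PFun X → Maybe X
    at-m t = fn t m
    old-or-new : ∀ am → fn a m ≡ am → fn (a ⊕ (m , x)) m ≡ fn (b ⊕ (m , x)) m
    old-or-new (just y) am = begin
      at-m (a ⊕ (m , x)) ≡⟨ cong at-m (⊕-absorb a m x y am) ⟩
      at-m a             ≡⟨ a≈b m ⟩
      at-m b             ≡⟨ cong at-m (sym (⊕-absorb b m x y (trans (sym (a≈b m)) am))) ⟩
      at-m (b ⊕ (m , x)) ∎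
      where open ≡-Reasoning
    old-or-new nothing  am = trans (⊕-new a m x am) (sym (⊕-new b m x (trans (sym (a≈b m)) am)))

  size-⊕-fresh : ∀ (t : PFun X) n x → fn t n ≡ nothing → size (t ⊕ (n , x)) ≡ suc (size t)
  size-⊕-fresh t n x tn = ≤-antisym at-most-one more
    where
    N : ℕ
    N = bound (t ⊕ (n , x)) ⊔ bound t
    at-most-one : size (t ⊕ (n , x)) ≤ suc (size t)
    at-most-one = subst₂ (λ a b → a ≤ suc b)
      (sym (size-at (t ⊕ (n , x)) N (m≤m⊔n _ _))) (sym (size-at t N (m≤n⊔m _ _)))
      (count-one-point (fn t) (fn (t ⊕ (n , x))) n (⊕-other t n x) N)
    more : suc (size t) ≤ size (t ⊕ (n , x))
    more = size-strict t (t ⊕ (n , x)) (⊕-extends t n x) n x tn (⊕-new t n x tn)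

module Thread {X : Set} (0X : X) (φ : (ℕ → X) → ℕ) (u : PFun X) where

  T : ℕ → PFun X
  T = thread 0X φ u

  n : ℕ → ℕ
  n = nφ 0X φ u

  Fresh : ℕ → Set
  Fresh i = (n i ∈dom u) × (fn (T i) (n i) ≡ nothing)

  thread-suc-just : ∀ i x → fn u (n i) ≡ just x → T (suc i) ≡ T i ⊕ (n i , x)
  thread-suc-just i x un rewrite un = refl

  thread-suc-nothing : ∀ i → fn u (n i) ≡ nothing → T (suc i) ≡ T i
  thread-suc-nothing i un rewrite un = refl

  step-cases : ∀ i → Fresh i ⊎ (T (suc i) ≡ T i)
  step-cases i = by-cases (fn u (n i)) refl (fn (T i) (n i)) refl
    where
    by-cases : ∀ ui → fn u (n i) ≡ ui → ∀ ti → fn (T i) (n i) ≡ ti → Fresh i ⊎ (T (suc i) ≡ T i)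
    by-cases nothing  un _        _  = inj₂ (thread-suc-nothing i un)
    by-cases (just x) un nothing  tn = inj₁ ((x , un) , tn)
    by-cases (just x) un (just y) tn =
      inj₂ (trans (thread-suc-just i x un) (⊕-absorb (T i) (n i) x y tn))

  thread-suc-fresh : ∀ i → (f : Fresh i) → T (suc i) ≡ T i ⊕ (n i , proj₁ (proj₁ f))
  thread-suc-fresh i ((x , un) , _) = thread-suc-just i x un

  thread-other : ∀ i m → m ≢ n i → fn (T (suc i)) m ≡ fn (T i) m
  thread-other i m m≢n with step-cases i
  ... | inj₂ same = cong (λ t → fn t m) same
  ... | inj₁ f rewrite thread-suc-fresh i f = ⊕-other (T i) (n i) _ m m≢n

  thread-step-⊑ : ∀ i → T i ⊑ T (suc i)
  thread-step-⊑ i with step-cases i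
  ... | inj₂ same rewrite same = λ _ _ e → e
  ... | inj₁ f rewrite thread-suc-fresh i f = ⊕-extends (T i) (n i) _

  thread-mono : ∀ {j k} → j ≤′ k → T j ⊑ T k
  thread-mono ≤′-refl     _ _ e = e
  thread-mono (≤′-step {k} j≤′k) m y e = thread-step-⊑ k m y (thread-mono j≤′k m y e)

  thread-⊑-u : ∀ i → T i ⊑ u
  thread-⊑-u zero _ _ ()
  thread-⊑-u (suc i) with step-cases i
  ... | inj₂ same rewrite same = thread-⊑-u i
  ... | inj₁ f@((x , un) , _) rewrite thread-suc-fresh i f = ⊕-⊑ (T i) u (n i) x (thread-⊑-u i) un

  thread-dom : ∀ i m y → fn (T i) m ≡ just y → Σ ℕ λ k → k < i × m ≡ n k
  thread-dom zero    m y ()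
  thread-dom (suc i) m y tm with m ≟ n i
  ... | yes m≡n = i , ≤-refl , m≡n
  ... | no m≢n with thread-dom i m y (trans (sym (thread-other i m m≢n)) tm)
  ... | k , k<i , m≡n = k , m<n⇒m<1+n k<i , m≡n

  size-fresh-step : ∀ i → Fresh i → size (T (suc i)) ≡ suc (size (T i))
  size-fresh-step i f@(_ , tn) =
    trans (cong size (thread-suc-fresh i f)) (size-⊕-fresh (T i) (n i) _ tn)

  size-thread-≤ : ∀ i → size (T i) ≤ i
  size-thread-≤ zero    = z≤n
  size-thread-≤ (suc i) with step-cases i
  ... | inj₂ same = m≤n⇒m≤1+n (subst (_≤ i) (cong size (sym same)) (size-thread-≤ i))
  ... | inj₁ f    = subst (_≤ suc i) (sym (size-fresh-step i f)) (s≤s (size-thread-≤ i))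

  full⇒fresh : ∀ k → size (T k) ≡ k → ∀ j → j < k → Fresh j
  full⇒fresh (suc k) full j j<k with step-cases k
  ... | inj₂ same = ⊥-elim (1+n≰n (subst (_≤ k) (trans (sym (cong size same)) full) (size-thread-≤ k)))
  ... | inj₁ f with m≤n⇒m<n∨m≡n (s≤s⁻¹ j<k)
  ... | inj₂ refl = f
  ... | inj₁ j<k′ = full⇒fresh k (suc-injective (trans (sym (size-fresh-step k f)) full)) j j<k′

  fresh⇒full : ∀ k → (∀ j → j < k → Fresh j) → size (T k) ≡ k
  fresh⇒full zero    _     = refl
  fresh⇒full (suc k) fresh = trans (size-fresh-step k (fresh k ≤-refl))
    (cong suc (fresh⇒full k (λ j j<k → fresh j (m<n⇒m<1+n j<k))))

  fresh⇒chain : ∀ i → (∀ j → j < i → Fresh j) → T i ≈† chain 0X φ u i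
  fresh⇒chain zero    _     _ = refl
  fresh⇒chain (suc i) fresh m = begin
    fn (T (suc i)) m                          ≡⟨ cong (λ t → fn t m) (thread-suc-just i x un) ⟩
    fn (T i ⊕ (n i , x)) m                    ≡⟨ ⊕-cong (T i) (chain 0X φ u i) (n i) x
                                                   (fresh⇒chain i (λ j j<i → fresh j (m<n⇒m<1+n j<i))) m ⟩
    fn (chain 0X φ u i ⊕ (n i , x)) m         ≡⟨ cong (λ z → fn (chain 0X φ u i ⊕ (n i , z)) m)
                                                   (sym (cong (fromMaybe 0X) un)) ⟩
    fn (chain 0X φ u (suc i)) m               ∎
    where
    open ≡-Reasoning
    x : X
    x = proj₁ (proj₁ (fresh i ≤-refl))
    un : fn u (n i) ≡ just x
    un = proj₂ (proj₁ (fresh i ≤-refl))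

  -- A point chosen by a fresh step stays in the thread, so later fresh
  -- steps choose different points.
  fresh-distinct : ∀ {j k} → j < k → Fresh j → Fresh k → n j ≢ n k
  fresh-distinct {j} {k} j<k ((x , un) , tn) (_ , tk) nj≡nk with
    thread-mono (≤⇒≤′ j<k) (n j) x
      (subst (λ t → fn t (n j) ≡ just x) (sym (thread-suc-just j x un)) (⊕-new (T j) (n j) x tn))
  ... | in-Tk rewrite nj≡nk with trans (sym tk) in-Tk
  ... | ()

  distinct⇒fresh : ∀ i → (∀ j k → j < i → k < i → j ≢ k → n j ≢ n k)
    → (∀ j → j < i → n j ∈dom u) → ∀ j → j < i → Fresh j
  distinct⇒fresh i distinct in-u j j<i = in-u j j<i , not-yet
    where
    not-yet : fn (T j) (n j) ≡ nothing
    not-yet with fn (T j) (n j) in tj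
    ... | nothing = refl
    ... | just y with thread-dom j (n j) y tj
    ... | k , k<j , nj≡nk = ⊥-elim (distinct j k j<i (<-trans k<j j<i) (>⇒≢ k<j) nj≡nk)

  l : ℕ
  l = size u

  thread⇒fresh : IsThread 0X φ u → ∀ j → j < l → Fresh j
  thread⇒fresh u≈T = full⇒fresh l (sym (size-cong u (T l) u≈T))

  fresh⇒thread : (∀ j → j < l → Fresh j) → IsThread 0X φ u
  fresh⇒thread fresh = λ m → sym (T≈u m)
    where
    T≈u : T l ≈† u
    T≈u = ⊑-size-≈ (T l) u (thread-⊑-u l) (≤-reflexive (sym (fresh⇒full l fresh)))

  fresh⇒cond : ∀ i → (∀ j → j < i → Fresh j) → ThreadCond 0X φ u i
  fresh⇒cond i fresh = fresh⇒chain i fresh , distinct , λ j j<i → proj₁ (fresh j j<i)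
    where
    distinct : ∀ j k → j < i → k < i → j ≢ k → n j ≢ n k
    distinct j k j<i k<i j≢k with <-cmp j k
    ... | tri< j<k _ _ = fresh-distinct j<k (fresh j j<i) (fresh k k<i)
    ... | tri≈ _ j≡k _ = ⊥-elim (j≢k j≡k)
    ... | tri> _ _ k<j = λ nj≡nk → fresh-distinct k<j (fresh k k<i) (fresh j j<i) (sym nj≡nk)

lemma2p4 : {X : Set} (0X : X) (φ : (ℕ → X) → ℕ) (u : PFun X)
    → ((IsThread 0X φ u → (∀ i → i ≤ size u → ThreadCond 0X φ u i))
       × ((∀ i → i ≤ size u → ThreadCond 0X φ u i) → IsThread 0X φ u))
    × (IsThread 0X φ u
       → (u ≈† thread 0X φ u (size u)) × (thread 0X φ u (size u) ≈† chain 0X φ u (size u)))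
lemma2p4 0X φ u = (only-if , if) , explicit
  where
  open Thread 0X φ u
  only-if : IsThread 0X φ u → ∀ i → i ≤ l → ThreadCond 0X φ u i
  only-if u≈T i i≤l = fresh⇒cond i (λ j j<i → thread⇒fresh u≈T j (<-≤-trans j<i i≤l))
  if : (∀ i → i ≤ l → ThreadCond 0X φ u i) → IsThread 0X φ u
  if cond with cond l ≤-refl
  ... | _ , distinct , in-u = fresh⇒thread (distinct⇒fresh l distinct in-u)
  explicit : IsThread 0X φ u → (u ≈† T l) × (T l ≈† chain 0X φ u l)
  explicit u≈T = u≈T , fresh⇒chain l (thread⇒fresh u≈T)
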